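{- Let $n\geqslant1$ and $X\subseteq\mathbb{Z}_n\setminus\{0\}$. Then $Dih(n,X,X)$ is a DSRG with parameters $(2n,2|X|,\mu,\lambda,t)$ if and only if $t=\mu$ and $\overline{x^X}\,\Delta_1=(\lambda-\mu)\overline{x^X}+\mu\overline{C_n}$ in $\mathbb{Z}[C_n]$, where $\Delta_1=\overline{x^X}+\overline{x^{ -X}}$.
   Context: $D_n=\langle x,a\mid x^n=1,\ a^2=1,\ ax=x^{ -1}a\rangle$, $C_n=\langle x\rangle$. $Dih(n,X,Y)$ is the Cayley digraph on $D_n$ with connection set $\{x^i:i\in X\}\cup\{x^ja:j\in Y\}$. A DSRG with parameters $(N,k,\mu,\lambda,t)$: adjacency matrix $A$ with $AJ=JA=kJ$ and $A^2=tI+\lambda A+\mu(J-I-A)$. For $A\subseteq\mathbb{Z}_n$, $\overline{x^A}=\sum_{i\in A}x^i\in\mathbb{Z}[C_n]$, $-A=\{ -i:i\in A\}$, $\overline{C_n}=\sum_{g\in C_n}g$. -}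

module Defs where

open import Data.Nat as ℕ using (ℕ; zero; suc; NonZero; _∸_)
open import Data.Nat.DivMod using (_mod_)
open import Data.Fin using (Fin; toℕ)
open import Data.Fin.Subset using (Subset)
open import Data.Bool using (Bool; true; false; if_then_else_; _xor_)
open import Data.Product using (_×_; _,_)
open import Data.Vec using (lookup)
open import Data.Integer using (ℤ; +_; _+_; _-_; _*_)
open import Relation.Binary.PropositionalEquality using (_≡_)
open import Relation.Nullary using (yes; no)
import Data.Bool as B

module _ {n : ℕ} .{{_ : NonZero n}} where
  addZ : Fin n → Fin n → Fin n
  addZ i j = (toℕ i ℕ.+ toℕ j) mod n

  negZ : Fin n → Fin n
  negZ i = (n ∸ toℕ i) mod n

  subZ : Fin n → Fin n → Fin n
  subZ i j = addZ i (negZ j)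

sumFin : (n : ℕ) → (Fin n → ℤ) → ℤ
sumFin zero    f = + 0
sumFin (suc n) f = f Fin.zero + sumFin n (λ i → f (Fin.suc i))
  where import Data.Fin as Fin

χ : Bool → ℤ
χ true  = + 1
χ false = + 0

-- The dihedral group D_n = ⟨x, a | x^n = 1, a^2 = 1, a x = x^{-1} a⟩.
-- The element (i , b) stands for x^i a^b  (b = false: x^i, b = true: x^i a).

D : ℕ → Set
D n = Fin n × Bool

module _ {n : ℕ} .{{_ : NonZero n}} where
  -- x^i a^b · x^j a^c = x^{i + (-1)^b j} a^{b xor c}
  _·D_ : D n → D n → D n
  (i , false) ·D (j , c) = addZ i j , c
  (i , true)  ·D (j , c) = subZ i j , (true xor c)

  invD : D n → D n
  invD (i , false) = negZ i , false
  invD (i , true)  = i , true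

  connDih : Subset n → Subset n → D n → Bool
  connDih X Y (i , false) = lookup X i
  connDih X Y (j , true)  = lookup Y j

  DihAdj : Subset n → Subset n → D n → D n → ℤ
  DihAdj X Y g h = χ (connDih X Y (invD g ·D h))

sumD : (n : ℕ) → (D n → ℤ) → ℤ
sumD n f = sumFin n (λ i → f (i , false)) + sumFin n (λ i → f (i , true))

δD : {n : ℕ} → D n → D n → ℤ
δD {n} (i , b) (j , c) with toℕ i ℕ.≟ toℕ j | b B.≟ c
... | yes _ | yes _ = + 1
... | _     | _     = + 0

-- Directed strongly regular graph with parameters (2n, k, μ, λ, t) on the
-- vertex set D n (|D n| = 2n), adjacency matrix A, J the all-ones matrix:
--   A J = k J,  J A = k J,  A² = t I + λ A + μ (J − I − A)   (entrywise).
record IsDSRG (n : ℕ) (A : D n → D n → ℤ) (k μ λ' t : ℕ) : Set where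
  field
    AJ : ∀ (u v : D n) → sumD n (λ w → A u w * + 1) ≡ + k
    JA : ∀ (u v : D n) → sumD n (λ w → + 1 * A w v) ≡ + k
    A² : ∀ (u v : D n) → sumD n (λ w → A u w * A w v)
                 ≡ (+ t * δD u v + + λ' * A u v) + + μ * ((+ 1 - δD u v) - A u v)

-- The group ring ℤ[C_n]: an element is its coefficient function Fin n → ℤ
-- (coefficient of x^i at i).
ZC : ℕ → Set
ZC n = Fin n → ℤ

module _ {n : ℕ} .{{_ : NonZero n}} where
  _⊛_ : ZC n → ZC n → ZC n
  (f ⊛ g) k = sumFin n (λ i → f i * g (subZ k i))

  _⊕_ : ZC n → ZC n → ZC n
  (f ⊕ g) k = f k + g k

  scal : ℤ → ZC n → ZC n
  scal c f k = c * f k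

  barX : Subset n → ZC n
  barX A i = χ (lookup A i)

  barNegX : Subset n → ZC n
  barNegX A i = χ (lookup A (negZ i))

  barC : ZC n
  barC _ = + 1

-- Since Y = X, whether x^i a^b → x^j a^c is an arc depends only on the rotation part r of
-- (x^i a^b)⁻¹ x^j a^c: the arc is present iff r ∈ X.  In a 2-walk, the middle vertices x^l and
-- x^l a together contribute f(r′)·Δ₁(s) for suitable r′, s, where f = \overline{x^X}; reindexing
-- by a translation or a reflection of ℤ_n (Δ₁ is symmetric) shows that the number of 2-walks
-- from g to h is (f Δ₁)(r).  Hence A² = tI + λA + μ(J − I − A) says, entrywise,
-- (f Δ₁)(r) = (λ − μ) f(r) + μ + (t − μ) δ.  Taking g = 1 and h = 1 (δ = 1) or h = a (δ = 0),
-- both with r = 0, forces t = μ, after which the entries are exactly the group ring identity.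
-- Row and column sums are 2|X| for every X.
module Submission where

open import Defs
open import Data.Nat using (ℕ; NonZero) renaming (_*_ to _*ℕ_)
open import Data.Fin using (Fin; toℕ)
open import Data.Fin.Subset using (Subset; _∈_; ∣_∣)
open import Data.Integer using (+_; _-_)
open import Data.Product using (_×_)
open import Function.Bundles using (_⇔_)
open import Relation.Binary.PropositionalEquality using (_≡_; _≢_)

open import Level using (0ℓ)
open import Algebra.Bundles using (AbelianGroup)
open import Algebra.Structures using (IsAbelianGroup)
open import Algebra.Consequences.Propositional using (comm∧idˡ⇒id; comm∧invˡ⇒inv)
import Algebra.Properties.AbelianGroup as AbelianGroupProperties
import Algebra.Properties.Group as GroupProperties
import Algebra.Properties.CommutativeMonoid.Sum as CommutativeMonoidSum
import Algebra.Properties.CommutativeSemigroup as CommutativeSemigroupProperties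
open import Data.Bool using (true; false)
import Data.Bool as Bool
open import Data.Empty using (⊥-elim)
open import Data.Fin using (zero; suc)
open import Data.Fin.Permutation using (Permutation′; permutation; _⟨$⟩ʳ_)
import Data.Fin.Properties as Fin
open import Data.Integer using (ℤ; _+_; _*_)
import Data.Integer.Properties as ℤ
open import Data.Integer.Solver using (module +-*-Solver)
import Data.Nat as ℕ
open import Data.Nat.DivMod using (_mod_; _%_; m%n<n; m<n⇒m%n≡m; %-distribˡ-+; m%n%n≡m%n; [m+n]%n≡m%n)
import Data.Nat.Properties as ℕ
open import Data.Product using (_,_; proj₁)
open import Data.Vec using (lookup; _∷_; [])
open import Function using (_∘_; mk⇔)
open import Relation.Binary.PropositionalEquality
  using (refl; sym; trans; cong; cong₂; module ≡-Reasoning)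
open import Relation.Binary.PropositionalEquality.Algebra using (isMagma)
open import Relation.Nullary using (yes; no)

module ℤₙ {n : ℕ} .{{_ : NonZero n}} where
  open ≡-Reasoning

  0ₙ : Fin n
  0ₙ = 0 mod n

  private
    toℕ-mod : ∀ m → toℕ (m mod n) ≡ m % n
    toℕ-mod m = Fin.toℕ-fromℕ< (m%n<n m n)

    mod-cong : ∀ {m m′} → m % n ≡ m′ % n → m mod n ≡ m′ mod n
    mod-cong {m} {m′} eq = Fin.toℕ-injective (begin
      toℕ (m mod n)  ≡⟨ toℕ-mod m ⟩
      m % n          ≡⟨ eq ⟩
      m′ % n         ≡⟨ toℕ-mod m′ ⟨
      toℕ (m′ mod n) ∎)

    toℕ-mod-inverse : ∀ (i : Fin n) → toℕ i mod n ≡ i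
    toℕ-mod-inverse i = Fin.toℕ-injective (trans (toℕ-mod _) (m<n⇒m%n≡m (Fin.toℕ<n i)))

    %-absorbˡ : ∀ m k → (m % n ℕ.+ k) % n ≡ (m ℕ.+ k) % n
    %-absorbˡ m k = begin
      (m % n ℕ.+ k) % n            ≡⟨ %-distribˡ-+ (m % n) k n ⟩
      (m % n % n ℕ.+ k % n) % n    ≡⟨ cong (λ r → (r ℕ.+ k % n) % n) (m%n%n≡m%n m n) ⟩
      (m % n ℕ.+ k % n) % n        ≡⟨ %-distribˡ-+ m k n ⟨
      (m ℕ.+ k) % n                ∎

    %-absorbʳ : ∀ m k → (m ℕ.+ k % n) % n ≡ (m ℕ.+ k) % n
    %-absorbʳ m k = begin
      (m ℕ.+ k % n) % n  ≡⟨ cong (_% n) (ℕ.+-comm m (k % n)) ⟩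
      (k % n ℕ.+ m) % n  ≡⟨ %-absorbˡ k m ⟩
      (k ℕ.+ m) % n      ≡⟨ cong (_% n) (ℕ.+-comm k m) ⟩
      (m ℕ.+ k) % n      ∎

  +-assoc : ∀ i j k → addZ (addZ i j) k ≡ addZ i (addZ j k)
  +-assoc i j k = mod-cong (begin
    (toℕ (addZ i j) ℕ.+ toℕ k) % n          ≡⟨ cong (λ r → (r ℕ.+ toℕ k) % n) (toℕ-mod _) ⟩
    ((toℕ i ℕ.+ toℕ j) % n ℕ.+ toℕ k) % n   ≡⟨ %-absorbˡ (toℕ i ℕ.+ toℕ j) (toℕ k) ⟩
    (toℕ i ℕ.+ toℕ j ℕ.+ toℕ k) % n         ≡⟨ cong (_% n) (ℕ.+-assoc (toℕ i) (toℕ j) (toℕ k)) ⟩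
    (toℕ i ℕ.+ (toℕ j ℕ.+ toℕ k)) % n       ≡⟨ %-absorbʳ (toℕ i) (toℕ j ℕ.+ toℕ k) ⟨
    (toℕ i ℕ.+ (toℕ j ℕ.+ toℕ k) % n) % n   ≡⟨ cong (λ r → (toℕ i ℕ.+ r) % n) (toℕ-mod _) ⟨
    (toℕ i ℕ.+ toℕ (addZ j k)) % n          ∎)

  +-comm : ∀ i j → addZ i j ≡ addZ j i
  +-comm i j = cong (_mod n) (ℕ.+-comm (toℕ i) (toℕ j))

  +-identityˡ : ∀ i → addZ 0ₙ i ≡ i
  +-identityˡ i = trans (mod-cong (begin
    (toℕ 0ₙ ℕ.+ toℕ i) % n   ≡⟨ cong (λ r → (r ℕ.+ toℕ i) % n) (toℕ-mod 0) ⟩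
    (0 % n ℕ.+ toℕ i) % n    ≡⟨ %-absorbˡ 0 (toℕ i) ⟩
    toℕ i % n                ∎)) (toℕ-mod-inverse i)

  +-inverseˡ : ∀ i → addZ (negZ i) i ≡ 0ₙ
  +-inverseˡ i = mod-cong (begin
    (toℕ (negZ i) ℕ.+ toℕ i) % n        ≡⟨ cong (λ r → (r ℕ.+ toℕ i) % n) (toℕ-mod _) ⟩
    ((n ℕ.∸ toℕ i) % n ℕ.+ toℕ i) % n   ≡⟨ %-absorbˡ (n ℕ.∸ toℕ i) (toℕ i) ⟩
    (n ℕ.∸ toℕ i ℕ.+ toℕ i) % n         ≡⟨ cong (_% n) (ℕ.m∸n+n≡m (ℕ.<⇒≤ (Fin.toℕ<n i))) ⟩
    n % n                               ≡⟨ [m+n]%n≡m%n 0 n ⟩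
    0 % n                               ∎)

  +-isAbelianGroup : IsAbelianGroup _≡_ addZ 0ₙ negZ
  +-isAbelianGroup = record
    { isGroup = record
      { isMonoid = record
        { isSemigroup = record { isMagma = isMagma addZ ; assoc = +-assoc }
        ; identity    = comm∧idˡ⇒id +-comm +-identityˡ
        }
      ; inverse = comm∧invˡ⇒inv +-comm +-inverseˡ
      ; ⁻¹-cong = cong negZ
      }
    ; comm = +-comm
    }

  +-abelianGroup : AbelianGroup 0ℓ 0ℓ
  +-abelianGroup = record { isAbelianGroup = +-isAbelianGroup }

open CommutativeMonoidSum ℤ.+-0-commutativeMonoid using (sum; ∑-distrib-+; sum-permute)

sumFin≡sum : ∀ {k} (g : Fin k → ℤ) → sumFin k g ≡ sum g
sumFin≡sum {ℕ.zero}  g = refl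
sumFin≡sum {ℕ.suc k} g = cong (_+_ (g zero)) (sumFin≡sum (g ∘ suc))

sumFin-cong : ∀ {k} {g h : Fin k → ℤ} → (∀ j → g j ≡ h j) → sumFin k g ≡ sumFin k h
sumFin-cong {ℕ.zero}  eq = refl
sumFin-cong {ℕ.suc k} eq = cong₂ _+_ (eq zero) (sumFin-cong (eq ∘ suc))

sumFin-distrib-+ : ∀ {k} (g h : Fin k → ℤ) →
                   sumFin k (λ j → g j + h j) ≡ sumFin k g + sumFin k h
sumFin-distrib-+ g h = begin
  sumFin _ (λ j → g j + h j)  ≡⟨ sumFin≡sum (λ j → g j + h j) ⟩
  sum (λ j → g j + h j)       ≡⟨ ∑-distrib-+ g h ⟩
  sum g + sum h               ≡⟨ cong₂ _+_ (sumFin≡sum g) (sumFin≡sum h) ⟨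
  sumFin _ g + sumFin _ h     ∎
  where open ≡-Reasoning

sumFin-permute : ∀ {k} (g : Fin k → ℤ) (π : Permutation′ k) →
                 sumFin k (g ∘ (π ⟨$⟩ʳ_)) ≡ sumFin k g
sumFin-permute g π = begin
  sumFin _ (g ∘ (π ⟨$⟩ʳ_))  ≡⟨ sumFin≡sum (g ∘ (π ⟨$⟩ʳ_)) ⟩
  sum (g ∘ (π ⟨$⟩ʳ_))       ≡⟨ sum-permute g π ⟨
  sum g                     ≡⟨ sumFin≡sum g ⟨
  sumFin _ g                ∎
  where open ≡-Reasoning

sumFin-χ-lookup : ∀ {k} (Y : Subset k) → sumFin k (χ ∘ lookup Y) ≡ + ∣ Y ∣
sumFin-χ-lookup []          = refl
sumFin-χ-lookup (true ∷ Y)  = cong (_+_ (+ 1)) (sumFin-χ-lookup Y)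
sumFin-χ-lookup (false ∷ Y) = cong (_+_ (+ 0)) (sumFin-χ-lookup Y)

module _ {n : ℕ} .{{_ : NonZero n}} where
  open ℤₙ {n}
  open AbelianGroup +-abelianGroup using (assoc; comm)
    renaming (_∙_ to _+ₙ_; _⁻¹ to -ₙ_; _-_ to _-ₙ_)
  open AbelianGroupProperties +-abelianGroup
    using (⁻¹-involutive; \\-leftDividesˡ; \\-leftDividesʳ; xyx⁻¹≈y; ⁻¹-∙-comm; ⁻¹-anti-homo‿-)
  open CommutativeSemigroupProperties (AbelianGroup.commutativeSemigroup +-abelianGroup)
    using (x∙yz≈yx∙z; x∙yz≈y∙xz)
  open ≡-Reasoning

  sumFin-translate : ∀ a (g : Fin n → ℤ) → sumFin n (λ j → g (a +ₙ j)) ≡ sumFin n g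
  sumFin-translate a g = sumFin-permute g (permutation (a +ₙ_) (-ₙ a +ₙ_)
    (\\-leftDividesˡ a) (\\-leftDividesʳ a))

  reflection-involutive : ∀ a j → a -ₙ (a -ₙ j) ≡ j
  reflection-involutive a j = begin
    a +ₙ -ₙ (a -ₙ j)  ≡⟨ cong (a +ₙ_) (⁻¹-anti-homo‿- a j) ⟩
    a +ₙ (j -ₙ a)     ≡⟨ assoc a j (-ₙ a) ⟨
    a +ₙ j -ₙ a       ≡⟨ xyx⁻¹≈y a j ⟩
    j                 ∎

  sumFin-reflect : ∀ a (g : Fin n → ℤ) → sumFin n (λ j → g (a -ₙ j)) ≡ sumFin n g
  sumFin-reflect a g = sumFin-permute g (permutation (λ j → a -ₙ j) (λ j → a -ₙ j)
    (reflection-involutive a) (reflection-involutive a))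

  ⊛-translate : ∀ (g h : ZC n) i k →
                sumFin n (λ j → g (-ₙ i +ₙ j) * h (k -ₙ j)) ≡ (g ⊛ h) (-ₙ i +ₙ k)
  ⊛-translate g h i k = trans (sym (sumFin-translate i _)) (sumFin-cong λ m →
    cong₂ (λ j l → g j * h l) (\\-leftDividesʳ i m) (begin
      k +ₙ -ₙ (i +ₙ m)       ≡⟨ cong (k +ₙ_) (⁻¹-∙-comm i m) ⟨
      k +ₙ (-ₙ i +ₙ -ₙ m)    ≡⟨ x∙yz≈yx∙z k (-ₙ i) (-ₙ m) ⟩
      -ₙ i +ₙ k +ₙ -ₙ m      ∎))

  ⊛-reflect : ∀ (g h : ZC n) → (∀ x → h (-ₙ x) ≡ h x) → ∀ i k →
              sumFin n (λ j → g (i -ₙ j) * h (k -ₙ j)) ≡ (g ⊛ h) (i -ₙ k)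
  ⊛-reflect g h h-symmetric i k = trans (sym (sumFin-reflect i _)) (sumFin-cong λ m →
    cong₂ (λ j l → g j * l) (reflection-involutive i m) (begin
      h (k -ₙ (i -ₙ m))       ≡⟨ cong (λ x → h (k +ₙ x)) (⁻¹-anti-homo‿- i m) ⟩
      h (k +ₙ (m -ₙ i))       ≡⟨ cong h (x∙yz≈y∙xz k m (-ₙ i)) ⟩
      h (m +ₙ (k -ₙ i))       ≡⟨ cong (λ x → h (m +ₙ x)) (⁻¹-anti-homo‿- i k) ⟨
      h (m -ₙ (i -ₙ k))       ≡⟨ cong h (⁻¹-anti-homo‿- (i -ₙ k) m) ⟨
      h (-ₙ (i -ₙ k -ₙ m))    ≡⟨ h-symmetric (i -ₙ k -ₙ m) ⟩
      h (i -ₙ k -ₙ m)         ∎))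

  Δ₁ : Subset n → ZC n
  Δ₁ X = barX X ⊕ barNegX X

  Δ₁-symmetric : ∀ X x → Δ₁ X (-ₙ x) ≡ Δ₁ X x
  Δ₁-symmetric X x = trans (cong (_+_ (barX X (-ₙ x))) (cong (barX X) (⁻¹-involutive x)))
                           (ℤ.+-comm (barX X (-ₙ x)) (barX X x))

+-double : ∀ m → + m + + m ≡ + (2 *ℕ m)
+-double m = cong (λ k → + (m ℕ.+ k)) (sym (ℕ.+-identityʳ m))

δD-refl : ∀ {n} (u : D n) → δD u u ≡ + 1
δD-refl (i , b) with toℕ i ℕ.≟ toℕ i | b Bool.≟ b
... | yes _ | yes _ = refl
... | no ¬p | _     = ⊥-elim (¬p refl)
... | yes _ | no ¬q = ⊥-elim (¬q refl)

δD-rotation-reflection : ∀ {n} (i j : Fin n) → δD (i , false) (j , true) ≡ + 0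
δD-rotation-reflection i j with toℕ i ℕ.≟ toℕ j
... | yes _ = refl
... | no _  = refl

module _ {n : ℕ} .{{_ : NonZero n}} (X : Subset n) where
  open ℤₙ {n}
  open AbelianGroup +-abelianGroup using (comm; identityˡ)
    renaming (_∙_ to _+ₙ_; _⁻¹ to -ₙ_; _-_ to _-ₙ_)
  open AbelianGroupProperties +-abelianGroup using (ε⁻¹≈ε; ⁻¹-anti-homo‿-)
  open ≡-Reasoning

  rotation : D n → D n → Fin n
  rotation g h = proj₁ (invD g ·D h)

  adjacency : ∀ g h → DihAdj X X g h ≡ barX X (rotation g h)
  adjacency (i , false) (j , false) = refl
  adjacency (i , false) (j , true)  = refl
  adjacency (i , true)  (j , false) = refl
  adjacency (i , true)  (j , true)  = refl

  rotation-ignores-flip : ∀ u j c → rotation u (j , c) ≡ rotation u (j , false)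
  rotation-ignores-flip (i , false) j c = refl
  rotation-ignores-flip (i , true)  j c = refl

  sumFin-rotation-from : ∀ u c (g : Fin n → ℤ) → sumFin n (λ j → g (rotation u (j , c))) ≡ sumFin n g
  sumFin-rotation-from (i , false) c g = sumFin-translate (-ₙ i) g
  sumFin-rotation-from (i , true)  c g = sumFin-reflect i g

  sumFin-rotation-to : ∀ b v (g : Fin n → ℤ) → sumFin n (λ j → g (rotation (j , b) v)) ≡ sumFin n g
  sumFin-rotation-to false (k , c) g =
    trans (sumFin-cong λ j → cong g (comm (-ₙ j) k)) (sumFin-reflect k g)
  sumFin-rotation-to true  (k , c) g =
    trans (sumFin-cong λ j → cong g (comm j (-ₙ k))) (sumFin-translate (-ₙ k) g)

  out-arcs-to-coset : ∀ u c → sumFin n (λ j → DihAdj X X u (j , c) * + 1) ≡ + ∣ X ∣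
  out-arcs-to-coset u c = begin
    sumFin n (λ j → DihAdj X X u (j , c) * + 1)  ≡⟨ sumFin-cong (λ j → trans (ℤ.*-identityʳ _) (adjacency u (j , c))) ⟩
    sumFin n (λ j → barX X (rotation u (j , c))) ≡⟨ sumFin-rotation-from u c (barX X) ⟩
    sumFin n (barX X)                            ≡⟨ sumFin-χ-lookup X ⟩
    + ∣ X ∣                                      ∎

  in-arcs-from-coset : ∀ b v → sumFin n (λ j → + 1 * DihAdj X X (j , b) v) ≡ + ∣ X ∣
  in-arcs-from-coset b v = begin
    sumFin n (λ j → + 1 * DihAdj X X (j , b) v)  ≡⟨ sumFin-cong (λ j → trans (ℤ.*-identityˡ _) (adjacency (j , b) v)) ⟩
    sumFin n (λ j → barX X (rotation (j , b) v)) ≡⟨ sumFin-rotation-to b v (barX X) ⟩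
    sumFin n (barX X)                            ≡⟨ sumFin-χ-lookup X ⟩
    + ∣ X ∣                                      ∎

  row-sum : ∀ u → sumD n (λ w → DihAdj X X u w * + 1) ≡ + (2 *ℕ ∣ X ∣)
  row-sum u = trans (cong₂ _+_ (out-arcs-to-coset u false) (out-arcs-to-coset u true)) (+-double ∣ X ∣)

  column-sum : ∀ v → sumD n (λ w → + 1 * DihAdj X X w v) ≡ + (2 *ℕ ∣ X ∣)
  column-sum v = trans (cong₂ _+_ (in-arcs-from-coset false v) (in-arcs-from-coset true v)) (+-double ∣ X ∣)

  arcs-into : ∀ j v → DihAdj X X (j , false) v + DihAdj X X (j , true) v ≡ Δ₁ X (proj₁ v -ₙ j)
  arcs-into j (k , c) = trans (cong₂ _+_ (adjacency (j , false) (k , c)) (adjacency (j , true) (k , c)))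
    (cong₂ (λ x y → barX X x + barX X y) (comm (-ₙ j) k) (sym (⁻¹-anti-homo‿- k j)))

  two-walks-as-sum : ∀ u v →
    sumD n (λ w → DihAdj X X u w * DihAdj X X w v)
      ≡ sumFin n (λ j → barX X (rotation u (j , false)) * Δ₁ X (proj₁ v -ₙ j))
  two-walks-as-sum u v = begin
    sumFin n (λ j → A u (j , false) * A (j , false) v) + sumFin n (λ j → A u (j , true) * A (j , true) v)
      ≡⟨ sumFin-distrib-+ (λ j → A u (j , false) * A (j , false) v) (λ j → A u (j , true) * A (j , true) v) ⟨
    sumFin n (λ j → A u (j , false) * A (j , false) v + A u (j , true) * A (j , true) v)
      ≡⟨ sumFin-cong factor ⟩
    sumFin n (λ j → barX X (rotation u (j , false)) * Δ₁ X (proj₁ v -ₙ j))  ∎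
    where
    A : D n → D n → ℤ
    A = DihAdj X X
    factor : ∀ j → A u (j , false) * A (j , false) v + A u (j , true) * A (j , true) v
                   ≡ barX X (rotation u (j , false)) * Δ₁ X (proj₁ v -ₙ j)
    factor j = begin
      A u (j , false) * A (j , false) v + A u (j , true) * A (j , true) v
        ≡⟨ cong₂ (λ x y → x * A (j , false) v + y * A (j , true) v)
                 (adjacency u (j , false))
                 (trans (adjacency u (j , true)) (cong (barX X) (rotation-ignores-flip u j true))) ⟩
      barX X r * A (j , false) v + barX X r * A (j , true) v
        ≡⟨ ℤ.*-distribˡ-+ (barX X r) _ _ ⟨
      barX X r * (A (j , false) v + A (j , true) v)
        ≡⟨ cong (barX X r *_) (arcs-into j v) ⟩
      barX X r * Δ₁ X (proj₁ v -ₙ j)  ∎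
      where
      r : Fin n
      r = rotation u (j , false)

  two-walks : ∀ u v → sumD n (λ w → DihAdj X X u w * DihAdj X X w v) ≡ (barX X ⊛ Δ₁ X) (rotation u v)
  two-walks (i , b) (k , c) = trans (two-walks-as-sum (i , b) (k , c)) (by-reindexing b)
    where
    by-reindexing : ∀ b → sumFin n (λ j → barX X (rotation (i , b) (j , false)) * Δ₁ X (k -ₙ j))
                          ≡ (barX X ⊛ Δ₁ X) (rotation (i , b) (k , c))
    by-reindexing false = ⊛-translate (barX X) (Δ₁ X) i k
    by-reindexing true  = ⊛-reflect (barX X) (Δ₁ X) (Δ₁-symmetric X) i k

  rotation-from-origin : ∀ k c → rotation (0ₙ , false) (k , c) ≡ k
  rotation-from-origin k c = trans (cong (_+ₙ k) ε⁻¹≈ε) (identityˡ k)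

dsrg-entry : ∀ (t λ' μ : ℕ) (d a : ℤ) →
  (+ t * d + + λ' * a) + + μ * ((+ 1 - d) - a) ≡ ((+ λ' - + μ) * a + + μ * + 1) + (+ t - + μ) * d
dsrg-entry t λ' μ d a =
  solve 5 (λ T L M D A → (T :* D :+ L :* A) :+ M :* ((con (+ 1) :- D) :- A)
                       := ((L :- M) :* A :+ M :* con (+ 1)) :+ (T :- M) :* D)
          refl (+ t) (+ λ') (+ μ) d a
  where open +-*-Solver

module _ {n : ℕ} .{{_ : NonZero n}} (X : Subset n) (μ λ' t : ℕ) where
  open ℤₙ {n}
  private module ℤ-+ = GroupProperties (AbelianGroup.group ℤ.+-0-abelianGroup)
  open ≡-Reasoning

  λμ-combination : ZC n
  λμ-combination = scal (+ λ' - + μ) (barX X) ⊕ scal (+ μ) barC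

  GroupRingIdentity : Set
  GroupRingIdentity = ∀ i → (barX X ⊛ Δ₁ X) i ≡ λμ-combination i

  two-walks-entry : IsDSRG n (DihAdj X X) (2 *ℕ ∣ X ∣) μ λ' t → ∀ u v →
    (barX X ⊛ Δ₁ X) (rotation X u v)
      ≡ λμ-combination (rotation X u v) + (+ t - + μ) * δD u v
  two-walks-entry dsrg u v = begin
    (barX X ⊛ Δ₁ X) (rotation X u v)              ≡⟨ two-walks X u v ⟨
    sumD n (λ w → DihAdj X X u w * DihAdj X X w v) ≡⟨ IsDSRG.A² dsrg u v ⟩
    (+ t * δD u v + + λ' * DihAdj X X u v) + + μ * ((+ 1 - δD u v) - DihAdj X X u v)
      ≡⟨ cong (λ a → (+ t * δD u v + + λ' * a) + + μ * ((+ 1 - δD u v) - a)) (adjacency X u v) ⟩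
    (+ t * δD u v + + λ' * a) + + μ * ((+ 1 - δD u v) - a)
      ≡⟨ dsrg-entry t λ' μ (δD u v) a ⟩
    ((+ λ' - + μ) * a + + μ * + 1) + (+ t - + μ) * δD u v ∎
    where
    a : ℤ
    a = barX X (rotation X u v)

  dsrg⇒t≡μ : IsDSRG n (DihAdj X X) (2 *ℕ ∣ X ∣) μ λ' t → t ≡ μ
  dsrg⇒t≡μ dsrg = ℤ.+-injective (ℤ.i-j≡0⇒i≡j (+ t) (+ μ) (begin
    + t - + μ                               ≡⟨ ℤ.*-identityʳ (+ t - + μ) ⟨
    (+ t - + μ) * + 1                       ≡⟨ cong (λ d → (+ t - + μ) * d) (δD-refl origin) ⟨
    (+ t - + μ) * δD origin origin          ≡⟨ ℤ-+.∙-cancelˡ (λμ-combination (rotation X origin origin)) _ _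
                                                 (trans (sym (two-walks-entry dsrg origin origin))
                                                        (two-walks-entry dsrg origin (0ₙ , true))) ⟩
    (+ t - + μ) * δD origin (0ₙ , true)     ≡⟨ cong (λ d → (+ t - + μ) * d) (δD-rotation-reflection 0ₙ 0ₙ) ⟩
    (+ t - + μ) * + 0                       ≡⟨ ℤ.*-zeroʳ (+ t - + μ) ⟩
    + 0                                     ∎))
    where
    origin : D n
    origin = (0ₙ , false)

  dsrg⇒group-ring-identity : IsDSRG n (DihAdj X X) (2 *ℕ ∣ X ∣) μ λ' t → GroupRingIdentity
  dsrg⇒group-ring-identity dsrg i = begin
    (barX X ⊛ Δ₁ X) i                    ≡⟨ cong (barX X ⊛ Δ₁ X) (rotation-from-origin X i true) ⟨
    (barX X ⊛ Δ₁ X) (rotation X origin v) ≡⟨ two-walks-entry dsrg origin v ⟩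
    λμ-combination (rotation X origin v) + (+ t - + μ) * δD origin v
      ≡⟨ cong₂ (λ r d → λμ-combination r + (+ t - + μ) * d) (rotation-from-origin X i true) (δD-rotation-reflection 0ₙ i) ⟩
    λμ-combination i + (+ t - + μ) * + 0            ≡⟨ cong (_+_ (λμ-combination i)) (ℤ.*-zeroʳ (+ t - + μ)) ⟩
    λμ-combination i + + 0                          ≡⟨ ℤ.+-identityʳ (λμ-combination i) ⟩
    λμ-combination i                                ∎
    where
    origin v : D n
    origin = (0ₙ , false)
    v = (i , true)

  group-ring-identity⇒A² : GroupRingIdentity → ∀ u v →
    sumD n (λ w → DihAdj X X u w * DihAdj X X w v)
      ≡ (+ μ * δD u v + + λ' * DihAdj X X u v) + + μ * ((+ 1 - δD u v) - DihAdj X X u v)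
  group-ring-identity⇒A² identity u v = begin
    sumD n (λ w → DihAdj X X u w * DihAdj X X w v)  ≡⟨ two-walks X u v ⟩
    (barX X ⊛ Δ₁ X) r                               ≡⟨ identity r ⟩
    rhs                                             ≡⟨ ℤ.+-identityʳ rhs ⟨
    rhs + + 0                                       ≡⟨ cong (_+_ rhs) (ℤ.*-zeroˡ (δD u v)) ⟨
    rhs + + 0 * δD u v                              ≡⟨ cong (λ z → rhs + z * δD u v) (ℤ.+-inverseʳ (+ μ)) ⟨
    rhs + (+ μ - + μ) * δD u v                      ≡⟨ dsrg-entry μ λ' μ (δD u v) (barX X r) ⟨
    (+ μ * δD u v + + λ' * barX X r) + + μ * ((+ 1 - δD u v) - barX X r)
      ≡⟨ cong (λ a → (+ μ * δD u v + + λ' * a) + + μ * ((+ 1 - δD u v) - a)) (adjacency X u v) ⟨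
    (+ μ * δD u v + + λ' * DihAdj X X u v) + + μ * ((+ 1 - δD u v) - DihAdj X X u v) ∎
    where
    r : Fin n
    r = rotation X u v
    rhs : ℤ
    rhs = λμ-combination r

  group-ring-identity⇒dsrg : t ≡ μ → GroupRingIdentity → IsDSRG n (DihAdj X X) (2 *ℕ ∣ X ∣) μ λ' t
  group-ring-identity⇒dsrg refl identity = record
    { AJ = λ u _ → row-sum X u
    ; JA = λ _ v → column-sum X v
    ; A² = group-ring-identity⇒A² identity
    }

lemma4p2 : (n : ℕ) .{{_ : NonZero n}} (X : Subset n)
    → (∀ (i : Fin n) → i ∈ X → toℕ i ≢ 0)
    → (μ λ' t : ℕ)
    → IsDSRG n (DihAdj X X) ((2 *ℕ ∣ X ∣)) μ λ' t
    ⇔ (t ≡ μ × (∀ (i : Fin n) → (barX X ⊛ (barX X ⊕ barNegX X)) i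
    ≡ (scal (+ λ' - + μ) (barX X) ⊕ scal (+ μ) barC) i))
-- The equivalence holds even if X contains 0 (loops).
lemma4p2 n X _ μ λ' t = mk⇔
  (λ dsrg → dsrg⇒t≡μ X μ λ' t dsrg , dsrg⇒group-ring-identity X μ λ' t dsrg)
  (λ (t≡μ , identity) → group-ring-identity⇒dsrg X μ λ' t t≡μ identity)
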